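{- Let $W$ be a minimal $k$-witness of a graph $G$ and consider any Grundy $k$-coloring of $W$. Then $W$ has radius at most $k$; more precisely, $W$ is entirely contained in the distance-$k$ neighborhood (in $W$) of the vertex colored $k$.
   Context: A $k$-coloring of a graph is a surjective map $\varphi:V\to\{1,\dots,k\}$; given a vertex ordering, $\varphi$ is first-fit with respect to it if each vertex $v$ has, for every $c<\varphi(v)$, an earlier neighbor colored $c$. A Grundy $k$-coloring is a proper $k$-coloring that is first-fit for some ordering; $\Gamma(H)$ is the maximum $k$ such that $H$ has one. A $k$-witness of $G$ is an induced subgraph $G'$ with $\Gamma(G')\geq k$; it is minimal if no proper induced subgraph of $G'$ has Grundy number at least $k$. The distance-$k$ neighborhood of $v$ is the set of vertices at distance at most $k$ from $v$. -}

module Defs where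

open import Data.Nat using (ℕ; zero; suc; _≤_; _<_)
open import Data.Fin using (Fin)
open import Data.Fin.Subset using (Subset; _∈_; _⊂_)
open import Data.Product using (Σ; ∃; ∃-syntax; _×_; _,_)
open import Relation.Binary.PropositionalEquality using (_≡_; _≢_)
open import Relation.Nullary using (¬_)

record Graph : Set₁ where
  field
    n     : ℕ
    Adj   : Fin n → Fin n → Set
    sym   : ∀ {u v} → Adj u v → Adj v u
    irrefl : ∀ {v} → ¬ Adj v v
open Graph public

-- Induced subgraphs of G are represented by their vertex sets S : Subset (n G).
-- Colorings use colors 1..k (natural numbers); values off S are irrelevant.

IsProperKColoring : (G : Graph) → Subset (n G) → ℕ → (Fin (n G) → ℕ) → Set
IsProperKColoring G S k φ =
    (∀ v → v ∈ S → 1 ≤ φ v × φ v ≤ k)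
  × (∀ c → 1 ≤ c → c ≤ k → ∃[ v ] (v ∈ S × φ v ≡ c))
  × (∀ u v → u ∈ S → v ∈ S → Adj G u v → φ u ≢ φ v)

-- A vertex ordering of S is given by an injective rank function on S
-- (u is earlier than v iff rank u < rank v).
IsOrderingOn : (G : Graph) → Subset (n G) → (Fin (n G) → ℕ) → Set
IsOrderingOn G S rank = ∀ u v → u ∈ S → v ∈ S → rank u ≡ rank v → u ≡ v

IsFirstFit : (G : Graph) → Subset (n G) → (Fin (n G) → ℕ) → (Fin (n G) → ℕ) → Set
IsFirstFit G S rank φ =
  ∀ v → v ∈ S → ∀ c → 1 ≤ c → c < φ v →
    ∃[ u ] (u ∈ S × Adj G u v × rank u < rank v × φ u ≡ c)

IsGrundyColoring : (G : Graph) → Subset (n G) → ℕ → (Fin (n G) → ℕ) → Set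
IsGrundyColoring G S k φ =
  IsProperKColoring G S k φ
  × ∃[ rank ] (IsOrderingOn G S rank × IsFirstFit G S rank φ)

GrundyAtLeast : (G : Graph) → Subset (n G) → ℕ → Set
GrundyAtLeast G S k = ∃[ k' ] (k ≤ k' × ∃[ φ ] IsGrundyColoring G S k' φ)

IsWitness : (G : Graph) → ℕ → Subset (n G) → Set
IsWitness G k S = GrundyAtLeast G S k

IsMinimalWitness : (G : Graph) → ℕ → Subset (n G) → Set
IsMinimalWitness G k S = IsWitness G k S × (∀ T → T ⊂ S → ¬ GrundyAtLeast G T k)

-- WalkIn G S d u v : there is a walk of length at most d from u to v
-- using only vertices of S (i.e. dist_{G[S]}(u,v) ≤ d).
data WalkIn (G : Graph) (S : Subset (n G)) : ℕ → Fin (n G) → Fin (n G) → Set where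
  here : ∀ {d v} → v ∈ S → WalkIn G S d v v
  step : ∀ {d u w v} → u ∈ S → Adj G u w → WalkIn G S d w v → WalkIn G S (suc d) u v

-- From the vertex x of colour k, repeatedly follow first-fit witnesses: a vertex of
-- colour c has, for each colour c' < c, an earlier neighbour of colour c'. The vertices
-- reached this way form a set closed under taking witnesses, so the colouring restricted
-- to it is still a Grundy k-colouring; by minimality it is all of W. Colours strictly
-- decrease along a chain of witnesses starting at colour k, so every vertex of W is
-- reached within k steps.
module Submission where

open import Defs
open import Data.Nat using (ℕ; zero; suc; _≤_; _<_; s≤s)
open import Data.Nat.Properties using (_≤?_; _<?_; ≤-refl; ≤-pred; <-≤-trans; n≤1+n; ≤-antisym; ≮⇒≥)
open import Data.Fin using (Fin)
open import Data.Fin.Subset using (Subset; _∈_; _⊆_; ⊥; ⁅_⁆; _∪_)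
open import Data.Fin.Subset.Properties using (_∈?_; ∉⊥; x∈⁅x⁆; x∈⁅y⁆⇒x≡y; x∈p∪q⁺; x∈p∪q⁻)
open import Data.List using (List; []; _∷_; foldr; concatMap; upTo)
open import Data.List.Relation.Unary.Any using (here; there)
open import Data.List.Membership.Propositional using (find; lose) renaming (_∈_ to _∈ˡ_)
open import Data.List.Membership.Propositional.Properties using (∈-concatMap⁺; ∈-concatMap⁻; ∈-upTo⁺; ∈-upTo⁻)
open import Data.Product using (∃-syntax; _×_; _,_; proj₁; proj₂)
open import Data.Sum using (inj₁; inj₂)
open import Data.Empty using (⊥-elim)
open import Relation.Nullary using (yes; no)
open import Relation.Binary.PropositionalEquality using (_≡_; refl; subst; trans) renaming (sym to ≡-sym)

fromList : ∀ {m} → List (Fin m) → Subset m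
fromList = foldr (λ y p → ⁅ y ⁆ ∪ p) ⊥

∈-fromList⁺ : ∀ {m} {x : Fin m} {xs} → x ∈ˡ xs → x ∈ fromList xs
∈-fromList⁺ {xs = y ∷ _} (here refl) = x∈p∪q⁺ (inj₁ (x∈⁅x⁆ y))
∈-fromList⁺ (there x∈xs) = x∈p∪q⁺ (inj₂ (∈-fromList⁺ x∈xs))

∈-fromList⁻ : ∀ {m} {x : Fin m} {xs} → x ∈ fromList xs → x ∈ˡ xs
∈-fromList⁻ {xs = []} x∈⊥ = ⊥-elim (∉⊥ x∈⊥)
∈-fromList⁻ {xs = y ∷ ys} x∈ with x∈p∪q⁻ ⁅ y ⁆ (fromList ys) x∈
... | inj₁ x∈⁅y⁆ = here (x∈⁅y⁆⇒x≡y y x∈⁅y⁆)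
... | inj₂ x∈ys = there (∈-fromList⁻ x∈ys)

walkIn-target∈ : ∀ {G S d u v} → WalkIn G S d u v → v ∈ S
walkIn-target∈ (here v∈S) = v∈S
walkIn-target∈ (step _ _ walk) = walkIn-target∈ walk

-- Definitionally the body of IsFirstFit, so values of either type can be used as the other.
FirstFitWitness : (G : Graph) → Subset (n G) → (Fin (n G) → ℕ) → (Fin (n G) → ℕ)
                → Fin (n G) → ℕ → Fin (n G) → Set
FirstFitWitness G S rank φ v c u = u ∈ S × Adj G u v × rank u < rank v × φ u ≡ c

-- Surjectivity onto colours below k comes from the first-fit witnesses of x.
firstFit-subset⇒grundy : ∀ {G k W T φ rank x} → IsProperKColoring G W k φ → IsOrderingOn G W rank
  → T ⊆ W → x ∈ T → φ x ≡ k → IsFirstFit G T rank φ → IsGrundyColoring G T k φ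
firstFit-subset⇒grundy {G} {k} {W} {T} {φ} {rank} {x} (range , onto , proper) ordered T⊆W x∈T φx≡k ffT =
  ( (λ v v∈T → range v (T⊆W v∈T))
  , ontoT
  , (λ u v u∈T v∈T → proper u v (T⊆W u∈T) (T⊆W v∈T)) )
  , rank , (λ u v u∈T v∈T → ordered u v (T⊆W u∈T) (T⊆W v∈T)) , ffT
  where
  ontoT : ∀ c → 1 ≤ c → c ≤ k → ∃[ v ] (v ∈ T × φ v ≡ c)
  ontoT c 1≤c c≤k with c <? k
  ... | no c≮k = x , x∈T , trans φx≡k (≤-antisym (≮⇒≥ c≮k) c≤k)
  ... | yes c<k with ffT x x∈T c 1≤c (subst (c <_) (≡-sym φx≡k) c<k)
  ...   | w , w∈T , _ , _ , φw≡c = w , w∈T , φw≡c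

minimalWitness⇒⊆ : ∀ {G k W T} → IsMinimalWitness G k W → T ⊆ W → GrundyAtLeast G T k → W ⊆ T
minimalWitness⇒⊆ {T = T} (_ , minimal) T⊆W grundyT {v} v∈W with v ∈? T
... | yes v∈T = v∈T
... | no v∉T = ⊥-elim (minimal T ((λ {y} → T⊆W {y}) , v , v∈W , v∉T) grundyT)

module WitnessChains (G : Graph) (W : Subset (n G)) (φ : Fin (n G) → ℕ)
                     (rank : Fin (n G) → ℕ) (ff : IsFirstFit G W rank φ) where

  V : Set
  V = Fin (n G)

  witnesses : V → ℕ → List V
  witnesses v c with v ∈? W | 1 ≤? c | c <? φ v
  ... | yes v∈W | yes 1≤c | yes c<φv = proj₁ (ff v v∈W c 1≤c c<φv) ∷ []
  ... | _ | _ | _ = []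

  ∈-witnesses⁻ : ∀ {v c w} → w ∈ˡ witnesses v c → 1 ≤ c × c < φ v × FirstFitWitness G W rank φ v c w
  ∈-witnesses⁻ {v} {c} w∈ with v ∈? W | 1 ≤? c | c <? φ v
  ∈-witnesses⁻ {v} {c} (here refl) | yes v∈W | yes 1≤c | yes c<φv = 1≤c , c<φv , proj₂ (ff v v∈W c 1≤c c<φv)
  ∈-witnesses⁻ (there ()) | yes _ | yes _ | yes _
  ∈-witnesses⁻ () | yes _ | yes _ | no _
  ∈-witnesses⁻ () | yes _ | no _ | _
  ∈-witnesses⁻ () | no _ | _ | _

  witnesses-nonempty : ∀ {v c} → v ∈ W → 1 ≤ c → c < φ v → ∃[ w ] (w ∈ˡ witnesses v c)
  witnesses-nonempty {v} {c} v∈W 1≤c c<φv with v ∈? W | 1 ≤? c | c <? φ v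
  ... | yes _ | yes _ | yes _ = _ , here refl
  ... | no v∉W | _ | _ = ⊥-elim (v∉W v∈W)
  ... | yes _ | no 1≰c | _ = ⊥-elim (1≰c 1≤c)
  ... | yes _ | yes _ | no c≮φv = ⊥-elim (c≮φv c<φv)

  reach : ℕ → V → List V
  reach zero    u = u ∷ []
  reach (suc d) u = u ∷ concatMap (λ c → concatMap (reach d) (witnesses u c)) (upTo (φ u))

  reach-self : ∀ d u → u ∈ˡ reach d u
  reach-self zero    u = here refl
  reach-self (suc d) u = here refl

  reach-step⁺ : ∀ {d u c w v} → w ∈ˡ witnesses u c → v ∈ˡ reach d w → v ∈ˡ reach (suc d) u
  reach-step⁺ {d} {u} w∈ v∈ =
    there (∈-concatMap⁺ (λ c → concatMap (reach d) (witnesses u c))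
            (lose (∈-upTo⁺ (proj₁ (proj₂ (∈-witnesses⁻ w∈)))) (∈-concatMap⁺ (reach d) (lose w∈ v∈))))

  reach-step⁻ : ∀ {d u v} → v ∈ˡ concatMap (λ c → concatMap (reach d) (witnesses u c)) (upTo (φ u))
              → ∃[ c ] ∃[ w ] (w ∈ˡ witnesses u c × v ∈ˡ reach d w)
  reach-step⁻ {d} {u} v∈ with find (∈-concatMap⁻ (λ c → concatMap (reach d) (witnesses u c)) {xs = upTo (φ u)} v∈)
  ... | c , _ , v∈c with find (∈-concatMap⁻ (reach d) {xs = witnesses u c} v∈c)
  ...   | w , w∈ , v∈w = c , w , w∈ , v∈w

  reach-walk : ∀ {d u v} → u ∈ W → v ∈ˡ reach d u → WalkIn G W d u v
  reach-walk {zero}  u∈W (here refl) = here u∈W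
  reach-walk {suc d} u∈W (here refl) = here u∈W
  reach-walk {suc d} u∈W (there v∈) with reach-step⁻ v∈
  ... | _ , _ , w∈ , v∈w with ∈-witnesses⁻ w∈
  ...   | _ , _ , w∈W , w~u , _ = step u∈W (Graph.sym G w~u) (reach-walk w∈W v∈w)

  -- Each witness has smaller colour, so a budget d with φ u ≤ 1 + d never runs out.
  reach-closed : ∀ d {u v c w} → φ u ≤ suc d → v ∈ˡ reach d u → w ∈ˡ witnesses v c → w ∈ˡ reach d u
  reach-closed zero φu≤1 (here refl) w∈ with ∈-witnesses⁻ w∈
  ... | s≤s _ , c<φu , _ with <-≤-trans c<φu φu≤1
  ...   | s≤s ()
  reach-closed (suc d) _ (here refl) w∈ = reach-step⁺ w∈ (reach-self d _)
  reach-closed (suc d) φu≤ (there v∈) w∈ with reach-step⁻ v∈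
  ... | c′ , w′ , w′∈ , v∈w′ with ∈-witnesses⁻ w′∈
  ...   | _ , c′<φu , _ , _ , _ , φw′≡c′ =
    reach-step⁺ w′∈ (reach-closed d φw′≤ v∈w′ w∈)
    where
    φw′≤ : φ w′ ≤ suc d
    φw′≤ = subst (_≤ suc d) (≡-sym φw′≡c′) (≤-pred (<-≤-trans c′<φu φu≤))

  reachable : ℕ → V → Subset (n G)
  reachable d u = fromList (reach d u)

  reachable⊆W : ∀ d {u} → u ∈ W → reachable d u ⊆ W
  reachable⊆W d {u} u∈W v∈ = walkIn-target∈ (reach-walk u∈W (∈-fromList⁻ {xs = reach d u} v∈))

  reachable-firstFit : ∀ d {u} → u ∈ W → φ u ≤ suc d → IsFirstFit G (reachable d u) rank φ
  reachable-firstFit d {u} u∈W φu≤ v v∈ c 1≤c c<φv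
    with witnesses-nonempty (reachable⊆W d u∈W v∈) 1≤c c<φv
  ... | w , w∈ with ∈-witnesses⁻ w∈
  ...   | _ , _ , _ , w~v , rank< , φw≡c =
    w , ∈-fromList⁺ (reach-closed d φu≤ (∈-fromList⁻ {xs = reach d u} v∈) w∈) , w~v , rank< , φw≡c

mainTheorem15 : (G : Graph) (k : ℕ) (W : Subset (n G)) → IsMinimalWitness G k W
                → (φ : Fin (n G) → ℕ) → IsGrundyColoring G W k φ
                → ∀ x → x ∈ W → φ x ≡ k
                → ∀ v → v ∈ W → WalkIn G W k x v
mainTheorem15 G k W minimal φ (proper , rank , ordered , ff) x x∈W φx≡k v v∈W =
  reach-walk x∈W (∈-fromList⁻ {xs = reach k x} (W⊆T v∈W))
  where
  open WitnessChains G W φ rank ff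
  T = reachable k x
  φx≤1+k : φ x ≤ suc k
  φx≤1+k = subst (_≤ suc k) (≡-sym φx≡k) (n≤1+n k)
  grundyT : IsGrundyColoring G T k φ
  grundyT = firstFit-subset⇒grundy {G} {k} {W} proper ordered (reachable⊆W k x∈W) (∈-fromList⁺ (reach-self k x))
                                    φx≡k (reachable-firstFit k x∈W φx≤1+k)
  W⊆T : W ⊆ T
  W⊆T = minimalWitness⇒⊆ {G} {k} {W} minimal (reachable⊆W k x∈W) (k , ≤-refl , φ , grundyT)
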